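{- The class ${2Eq}_{\mathrm{fin}}$ is $\Sigma_1$-interpretable (without parameters) in the class ${LEq}_{\mathrm{fin}}$.
   Context: Signatures contain no function symbols. ${2Eq}_{\mathrm{fin}}$ is the class of all finite structures in the signature $\{P^2,Q^2\}$ in which both $P$ and $Q$ are equivalence relations. ${LEq}_{\mathrm{fin}}$ is the class of all finite structures in the signature $\{<^2,\approx^2\}$ in which $<$ is a (strict) linear order and $\approx$ is an equivalence relation. A $\sigma_2$-scheme in $\sigma_1$ (without parameters) is a collection of $\sigma_2$-formulas $\Phi_U(x)$ and, for each $n$-ary predicate symbol $R$ of $\sigma_1$, formulas $\Phi_R(x_1,\dots,x_n)$ and $\Phi_{\neg R}(x_1,\dots,x_n)$. For $\mathcal{K}_1$ a class of $\sigma_1$-structures and $\mathcal{K}_2$ a class of $\sigma_2$-structures, $\mathcal{K}_1$ is interpretable in $\mathcal{K}_2$ if there is such a scheme such that for every $\mathfrak{A}\in\mathcal{K}_1$ there is $\mathfrak{B}\in\mathcal{K}_2$ with: (1) $B':=\{b\in B:\mathfrak{B}\models\Phi_U(b)\}$ is nonempty; (2) for every $n$-ary $R$ of $\sigma_1$ and all $\bar b\in (B')^n$, $\mathfrak{B}\models\Phi_{\neg R}(\bar b)$ iff $\mathfrak{B}\not\models\Phi_R(\bar b)$; (3) $\mathfrak{A}$ is isomorphic to the $\sigma_1$-structure $\mathfrak{B}'$ with universe $B'$ in which $\mathfrak{B}'\models R(\bar b)$ iff $\mathfrak{B}\models\Phi_R(\bar b)$. It is $\Sigma_k$-interpretable if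 moreover all formulas of the scheme are $\Sigma_k$-formulas (prenex formulas with exactly $k$ alternating quantifier blocks starting with $\exists$ and quantifier-free matrix). -}

module Defs where

open import Level using (0ℓ)
open import Data.Nat using (ℕ; zero; suc; _+_; _<_)
open import Data.Fin using (Fin; zero; suc)
open import Data.Vec.Functional using (_++_)
open import Data.Product using (Σ; _×_; ∃)
open import Data.Sum using (_⊎_)
open import Relation.Nullary using (¬_)
open import Relation.Binary using (Rel; IsEquivalence; IsStrictTotalOrder)
open import Relation.Binary.PropositionalEquality using (_≡_)
open import Function.Definitions using (Injective)
open import Function.Bundles using (_⇔_)

-- Relational signatures in which every predicate symbol is binary
-- (both signatures of the paper are of this kind; no function symbols).

data Sym2Eq : Set where
  P Q : Sym2Eq

data SymLEq : Set where
  lt eqv : SymLEq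

-- A finite structure (nonempty universe) in a signature with binary symbols S.
-- Every finite structure is isomorphic to one with universe Fin size.
record Structure (S : Set) : Set₁ where
  field
    size     : ℕ
    nonempty : 0 < size
    rel      : S → Rel (Fin size) 0ℓ
open Structure public

data QF (S : Set) (k : ℕ) : Set where
  atom  : S → Fin k → Fin k → QF S k
  equal : Fin k → Fin k → QF S k
  neg   : QF S k → QF S k
  and   : QF S k → QF S k → QF S k
  or    : QF S k → QF S k → QF S k

⟦_⟧qf : ∀ {S k} → QF S k → (M : Structure S) → (Fin k → Fin (size M)) → Set
⟦ atom s i j ⟧qf M ρ = rel M s (ρ i) (ρ j)
⟦ equal i j  ⟧qf M ρ = ρ i ≡ ρ j
⟦ neg φ      ⟧qf M ρ = ¬ ⟦ φ ⟧qf M ρ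
⟦ and φ ψ    ⟧qf M ρ = ⟦ φ ⟧qf M ρ × ⟦ ψ ⟧qf M ρ
⟦ or φ ψ     ⟧qf M ρ = ⟦ φ ⟧qf M ρ ⊎ ⟦ ψ ⟧qf M ρ

-- Σ₁-formulas with free variables Fin k: ∃ y₀ … y_{m-1} . matrix,
-- the matrix being quantifier-free in variables (bound ones first, then free).
record Σ₁ (S : Set) (k : ℕ) : Set where
  constructor ∃∃
  field
    nbound : ℕ
    matrix : QF S (nbound + k)
open Σ₁ public

⟦_⟧ : ∀ {S k} → Σ₁ S k → (M : Structure S) → (Fin k → Fin (size M)) → Set
⟦ ∃∃ m φ ⟧ M ρ = Σ (Fin m → Fin (size M)) λ w → ⟦ φ ⟧qf M (w ++ ρ)

one : ∀ {A : Set} → A → Fin 1 → A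
one a _ = a

two : ∀ {A : Set} → A → A → Fin 2 → A
two a b zero    = a
two a b (suc _) = b

record Scheme (S₁ S₂ : Set) : Set where
  field
    ΦU    : Σ₁ S₂ 1
    ΦR    : S₁ → Σ₁ S₂ 2
    Φ¬R   : S₁ → Σ₁ S₂ 2
open Scheme public

record Interprets {S₁ S₂ : Set} (Φ : Scheme S₁ S₂)
                  (A : Structure S₁) (B : Structure S₂) : Set where
  U : Fin (size B) → Set
  U b = ⟦ ΦU Φ ⟧ B (one b)
  R : S₁ → Fin (size B) → Fin (size B) → Set
  R s x y = ⟦ ΦR Φ s ⟧ B (two x y)
  field
    B'-nonempty : ∃ λ b → U b
    complement  : ∀ s x y → U x → U y → (⟦ Φ¬R Φ s ⟧ B (two x y) ⇔ (¬ R s x y))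
    iso         : Fin (size A) → Fin (size B)
    iso-inj     : Injective _≡_ _≡_ iso
    iso-into    : ∀ a → U (iso a)
    iso-onto    : ∀ b → U b → ∃ λ a → iso a ≡ b
    iso-rel     : ∀ s a a' → (rel A s a a' ⇔ R s (iso a) (iso a'))

Is2Eq : Structure Sym2Eq → Set
Is2Eq M = ∀ s → IsEquivalence (rel M s)

IsLEq : Structure SymLEq → Set
IsLEq M = IsStrictTotalOrder _≡_ (rel M lt) × IsEquivalence (rel M eqv)

Σ₁-Interpretable : ∀ {S₁ S₂ : Set} → (Structure S₁ → Set) → (Structure S₂ → Set) → Set₁
Σ₁-Interpretable {S₁} {S₂} K₁ K₂ =
  Σ (Scheme S₁ S₂) λ Φ → ∀ (A : Structure S₁) → K₁ A →
    Σ (Structure S₂) λ B → K₂ B × Interprets Φ A B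

-- Let G₀, G₁, G₂, G₃ be P, ¬P, Q, ¬Q. Every element a of A becomes a block of B consisting of six
-- markers forming one ≈-class, the centre a (a singleton class) between the first two markers, and
-- between consecutive later markers a zone k holding one slot (a, k, b) for every b; the slot (a, k, b)
-- is ≈ to (b, k, a) exactly when Gₖ a b. Classes of centres and slots have at most two elements, so a
-- strictly increasing ≈-chain of six points is precisely the marker row of a block. Hence an existential
-- formula can locate the centre and the zones of a block: x is in the universe iff it is a centre,
-- "x P y" says that a slot of zone 0 of x is ≈ to one of zone 0 of y (which, P being reflexive, gives
-- a = a′ or P a a′, i.e. P a a′), and "x ¬P y" says the same for zone 1 with distinct slots.
module Submission where

open import Defs
open import Level using (0ℓ)
open import Data.Empty using (⊥-elim)
open import Data.Unit using (⊤; tt)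
open import Data.Nat using (ℕ; suc; _+_; _*_; _<_; z≤n; s≤s)
import Data.Nat.Properties as ℕ
open import Data.Fin using (Fin; zero; suc; toℕ; inject₁; _↑ˡ_; _↑ʳ_; #_; splitAt; fromℕ<)
open import Data.Fin.Patterns using (0F; 1F; 2F; 3F; 4F; 5F)
open import Data.Fin.Properties using (toℕ-injective; toℕ-inject₁; toℕ<n; +↔⊎; *↔×; 1↔⊤)
open import Data.Vec using (Vec; []; _∷_)
open import Data.Vec.Functional using (_++_)
open import Data.Vec.Functional.Properties using (++-cong; lookup-++ˡ; lookup-++ʳ)
open import Data.Vec.Relation.Binary.Pointwise.Inductive using (Pointwise; []; _∷_)
open import Data.Vec.Relation.Binary.Lex.Strict as Lex using (Lex-<; base; this; next)
open import Data.Product using (Σ; ∃-syntax; ∃₂; _×_; _,_; proj₁)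
open import Data.Product.Function.NonDependent.Propositional using (_×-⇔_; _×-↔_)
open import Data.Sum using (_⊎_; inj₁; inj₂; [_,_])
open import Data.Sum.Properties using ([,]-∘)
open import Data.Sum.Function.Propositional using (_⊎-⇔_; _⊎-↔_)
open import Function using (_∘_; _on_; id)
open import Function.Bundles using (_⇔_; _↔_; mk⇔; Equivalence; Inverse; Injection)
open import Function.Construct.Identity using (⇔-id)
open import Function.Construct.Composition using (_⇔-∘_)
open import Function.Construct.Symmetry using (⇔-sym)
open import Function.Properties.Equivalence using (⇔-setoid)
open import Function.Properties.Inverse using (↔-refl; ↔-trans; ↔-sym; ↔⇒↣)
open import Function.Related.TypeIsomorphisms using (¬-cong-⇔)
open import Relation.Nullary using (¬_)
open import Relation.Nullary.Negation using (_¬-⊎_)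
open import Relation.Binary
  using (Rel; IsEquivalence; IsStrictTotalOrder; Symmetric; Transitive; Reflexive; Tri; tri<; tri≈; tri>)
import Relation.Binary.Construct.On as On
open import Relation.Binary.PropositionalEquality
  using (_≡_; _≢_; refl; sym; trans; cong; cong₂; subst; subst₂; _≗_; resp₂; isEquivalence)
import Relation.Binary.Reasoning.Setoid as SetoidReasoning

isStrictTotalOrder-on : ∀ {a b ℓ₁ ℓ₂} {A : Set a} {B : Set b} {_≈_ : Rel B ℓ₁} {_<_ : Rel B ℓ₂}
                        (f : A → B) → (∀ {x y} → f x ≈ f y → x ≡ y) →
                        IsStrictTotalOrder _≈_ _<_ → IsStrictTotalOrder _≡_ (_<_ on f)
isStrictTotalOrder-on {_≈_ = _≈_} {_<_} f injective sto = record
  { isStrictPartialOrder = record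
    { isEquivalence = isEquivalence
    ; irrefl        = λ { refl → O.irrefl O.Eq.refl }
    ; trans         = O.trans
    ; <-resp-≈      = resp₂ (_<_ on f)
    }
  ; compare = λ x y → compare-on (O.compare (f x) (f y))
  }
  where
  module O = IsStrictTotalOrder sto

  ≢-on : ∀ {x y} → ¬ f x ≈ f y → x ≢ y
  ≢-on fx≉fy refl = fx≉fy O.Eq.refl

  compare-on : ∀ {x y} → Tri (f x < f y) (f x ≈ f y) (f y < f x) → Tri (f x < f y) (x ≡ y) (f y < f x)
  compare-on (tri< x<y x≉y y≮x) = tri< x<y (≢-on x≉y) y≮x
  compare-on (tri≈ x≮y x≈y y≮x) = tri≈ x≮y (injective x≈y) y≮x
  compare-on (tri> x≮y x≉y y<x) = tri> x≮y (≢-on x≉y) y<x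

subst₂-⇔ : ∀ {a ℓ} {A : Set a} (T : Rel A ℓ) {x x′ y y′} → x ≡ x′ → y ≡ y′ → T x y ⇔ T x′ y′
subst₂-⇔ T refl refl = ⇔-id _

¬⊎⇔¬×¬ : ∀ {a b} {A : Set a} {B : Set b} → (¬ A × ¬ B) ⇔ (¬ (A ⊎ B))
¬⊎⇔¬×¬ = mk⇔ (λ (¬a , ¬b) → ¬a ¬-⊎ ¬b) (λ ¬a⊎b → ¬a⊎b ∘ inj₁ , ¬a⊎b ∘ inj₂)

increasing-below-six : ∀ {t₀ t₁ t₂ t₃ t₄ t₅} → t₀ < t₁ → t₁ < t₂ → t₂ < t₃ → t₃ < t₄ → t₄ < t₅ → t₅ < 6 →
                       t₀ ≡ 0 × t₁ ≡ 1 × t₂ ≡ 2 × t₃ ≡ 3 × t₄ ≡ 4 × t₅ ≡ 5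
increasing-below-six t₀<t₁ t₁<t₂ t₂<t₃ t₃<t₄ t₄<t₅ t₅<6 =
  ℕ.≤-antisym u₀ z≤n , ℕ.≤-antisym u₁ l₁ , ℕ.≤-antisym u₂ l₂ , ℕ.≤-antisym u₃ l₃ , ℕ.≤-antisym u₄ l₄ , ℕ.≤-antisym u₅ l₅
  where
  l₁ = ℕ.≤-trans (s≤s z≤n) t₀<t₁
  l₂ = ℕ.≤-trans (s≤s l₁) t₁<t₂
  l₃ = ℕ.≤-trans (s≤s l₂) t₂<t₃
  l₄ = ℕ.≤-trans (s≤s l₃) t₃<t₄
  l₅ = ℕ.≤-trans (s≤s l₄) t₄<t₅
  u₅ = ℕ.≤-pred t₅<6
  u₄ = ℕ.≤-pred (ℕ.≤-trans t₄<t₅ u₅)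
  u₃ = ℕ.≤-pred (ℕ.≤-trans t₃<t₄ u₄)
  u₂ = ℕ.≤-pred (ℕ.≤-trans t₂<t₃ u₃)
  u₁ = ℕ.≤-pred (ℕ.≤-trans t₁<t₂ u₂)
  u₀ = ℕ.≤-pred (ℕ.≤-trans t₀<t₁ u₁)

_<ˡ_ : ∀ {k} → Rel (Vec ℕ k) 0ℓ
_<ˡ_ = Lex-< _≡_ _<_

squeeze : ∀ {c k c′ s t u} →
          (c ∷ k ∷ 0 ∷ 0 ∷ []) <ˡ (c′ ∷ s ∷ t ∷ u ∷ []) → (c′ ∷ s ∷ t ∷ u ∷ []) <ˡ (c ∷ suc k ∷ 0 ∷ 0 ∷ []) →
          c′ ≡ c × s ≡ k × (0 ∷ 0 ∷ []) <ˡ (t ∷ u ∷ [])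
squeeze (this c<c′ _)            (this c′<c _)            = ⊥-elim (ℕ.<-asym c<c′ c′<c)
squeeze (this c<c _)             (next refl _)            = ⊥-elim (ℕ.<-irrefl refl c<c)
squeeze (next refl _)            (this c<c _)             = ⊥-elim (ℕ.<-irrefl refl c<c)
squeeze (next refl (this k<s _)) (next refl (this s<k+1 _)) = ⊥-elim (ℕ.<-irrefl refl (ℕ.<-≤-trans k<s (ℕ.≤-pred s<k+1)))
squeeze (next refl (this _ _))   (next refl (next refl (this () _)))
squeeze (next refl (this _ _))   (next refl (next refl (next refl (this () _))))
squeeze (next refl (this _ _))   (next refl (next refl (next refl (next _ (base ())))))
squeeze (next refl (next refl r)) (next refl (this _ _)) = refl , refl , r

module Semantics {S X : Set} (R : S → Rel X 0ℓ) where

  ⟦_⟧qfᴿ : ∀ {k} → QF S k → (Fin k → X) → Set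
  ⟦ atom s i j ⟧qfᴿ σ = R s (σ i) (σ j)
  ⟦ equal i j  ⟧qfᴿ σ = σ i ≡ σ j
  ⟦ neg φ      ⟧qfᴿ σ = ¬ ⟦ φ ⟧qfᴿ σ
  ⟦ and φ ψ    ⟧qfᴿ σ = ⟦ φ ⟧qfᴿ σ × ⟦ ψ ⟧qfᴿ σ
  ⟦ or φ ψ     ⟧qfᴿ σ = ⟦ φ ⟧qfᴿ σ ⊎ ⟦ ψ ⟧qfᴿ σ

  ⟦_⟧ᴿ : ∀ {k} → Σ₁ S k → (Fin k → X) → Set
  ⟦ ∃∃ m φ ⟧ᴿ σ = Σ (Fin m → X) λ w → ⟦ φ ⟧qfᴿ (w ++ σ)

  ⟦⟧qfᴿ-cong : ∀ {k} (φ : QF S k) {σ τ} → σ ≗ τ → ⟦ φ ⟧qfᴿ σ ⇔ ⟦ φ ⟧qfᴿ τ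
  ⟦⟧qfᴿ-cong (atom s i j) σ≗τ = subst₂-⇔ (R s) (σ≗τ i) (σ≗τ j)
  ⟦⟧qfᴿ-cong (equal i j)  σ≗τ = subst₂-⇔ _≡_ (σ≗τ i) (σ≗τ j)
  ⟦⟧qfᴿ-cong (neg φ)      σ≗τ = ¬-cong-⇔ (⟦⟧qfᴿ-cong φ σ≗τ)
  ⟦⟧qfᴿ-cong (and φ ψ)    σ≗τ = ⟦⟧qfᴿ-cong φ σ≗τ ×-⇔ ⟦⟧qfᴿ-cong ψ σ≗τ
  ⟦⟧qfᴿ-cong (or φ ψ)     σ≗τ = ⟦⟧qfᴿ-cong φ σ≗τ ⊎-⇔ ⟦⟧qfᴿ-cong ψ σ≗τ

  ⟦⟧ᴿ-cong : ∀ {k} (φ : Σ₁ S k) {σ τ} → σ ≗ τ → ⟦ φ ⟧ᴿ σ ⇔ ⟦ φ ⟧ᴿ τ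
  ⟦⟧ᴿ-cong (∃∃ m φ) σ≗τ =
    mk⇔ (λ (w , h) → w , Equivalence.to (matrix-cong w) h) (λ (w , h) → w , Equivalence.from (matrix-cong w) h)
    where
    matrix-cong : ∀ w → ⟦ φ ⟧qfᴿ (w ++ _) ⇔ ⟦ φ ⟧qfᴿ (w ++ _)
    matrix-cong w = ⟦⟧qfᴿ-cong φ (++-cong w w (λ _ → refl) σ≗τ)

-- A Structure has carrier Fin N; the gadget is built on a more convenient carrier and moved along a bijection.
module Transport {S X : Set} (R : S → Rel X 0ℓ) {N : ℕ} (N>0 : 0 < N) (e : Fin N ↔ X) where
  open Inverse e public using (to; from; strictlyInverseˡ; strictlyInverseʳ)
  open Semantics R

  to-injective : ∀ {i j} → to i ≡ to j → i ≡ j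
  to-injective = Injection.injective (↔⇒↣ e)

  from-injective : ∀ {x y} → from x ≡ from y → x ≡ y
  from-injective = Injection.injective (↔⇒↣ (↔-sym e))

  structure : Structure S
  structure = record { size = N ; nonempty = N>0 ; rel = λ s i j → R s (to i) (to j) }

  to-++ : ∀ {m k} (w : Fin m → Fin N) (ρ : Fin k → Fin N) → to ∘ (w ++ ρ) ≗ (to ∘ w) ++ (to ∘ ρ)
  to-++ {m} w ρ i = [,]-∘ to (splitAt m i)

  ⟦⟧qf-transport : ∀ {k} (φ : QF S k) ρ → ⟦ φ ⟧qf structure ρ ⇔ ⟦ φ ⟧qfᴿ (to ∘ ρ)
  ⟦⟧qf-transport (atom s i j) ρ = ⇔-id _
  ⟦⟧qf-transport (equal i j)  ρ = mk⇔ (cong to) to-injective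
  ⟦⟧qf-transport (neg φ)      ρ = ¬-cong-⇔ (⟦⟧qf-transport φ ρ)
  ⟦⟧qf-transport (and φ ψ)    ρ = ⟦⟧qf-transport φ ρ ×-⇔ ⟦⟧qf-transport ψ ρ
  ⟦⟧qf-transport (or φ ψ)     ρ = ⟦⟧qf-transport φ ρ ⊎-⇔ ⟦⟧qf-transport ψ ρ

  ⟦⟧-transport : ∀ {k} (φ : Σ₁ S k) ρ → ⟦ φ ⟧ structure ρ ⇔ ⟦ φ ⟧ᴿ (to ∘ ρ)
  ⟦⟧-transport (∃∃ m φ) ρ = mk⇔
    (λ (w , h) → to ∘ w , Equivalence.to (⟦⟧qfᴿ-cong φ (to-++ w ρ) ⇔-∘ ⟦⟧qf-transport φ (w ++ ρ)) h)
    (λ (w , h) → from ∘ w , Equivalence.from (⟦⟧qfᴿ-cong φ (from-++ w) ⇔-∘ ⟦⟧qf-transport φ _) h)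
    where
    from-++ : ∀ w → to ∘ ((from ∘ w) ++ ρ) ≗ w ++ (to ∘ ρ)
    from-++ w i = trans (to-++ (from ∘ w) ρ i) (++-cong (to ∘ from ∘ w) w (strictlyInverseˡ ∘ w) (λ _ → refl) i)

Inner : ℕ → Set
Inner n = Fin 6 ⊎ (⊤ ⊎ (Fin 4 × Fin n))

pattern marker i = inj₁ i
pattern centre   = inj₂ (inj₁ tt)
pattern slot k b = inj₂ (inj₂ (k , b))

Point : ℕ → Set
Point n = Fin n × Inner n

point↔ : ∀ {n} → Fin (n * (6 + (1 + 4 * n))) ↔ Point n
point↔ = ↔-trans *↔× (↔-refl ×-↔ ↔-trans +↔⊎ (↔-refl ⊎-↔ ↔-trans +↔⊎ (1↔⊤ ⊎-↔ *↔×)))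

blockMarkers : ∀ {n} → Fin n → Fin 6 → Point n
blockMarkers a i = a , marker i

module _ {n : ℕ} where

  -- Inside the block of a:  marker 0 < centre < marker 1 < slots of zone 0 < marker 2 < … < slots of zone 3 < marker 5.
  key : Point n → Vec ℕ 4
  key (a , marker i) = toℕ a ∷ toℕ i ∷ 0 ∷ 0 ∷ []
  key (a , centre)   = toℕ a ∷ 0 ∷ 1 ∷ 0 ∷ []
  key (a , slot k b) = toℕ a ∷ suc (toℕ k) ∷ 1 ∷ toℕ b ∷ []

  _<ᵖ_ : Rel (Point n) 0ℓ
  _<ᵖ_ = _<ˡ_ on key

  key-injective : ∀ {p q} → Pointwise _≡_ (key p) (key q) → p ≡ q
  key-injective {a , marker i} {b , marker j} (a≡b ∷ i≡j ∷ _) =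
    cong₂ blockMarkers (toℕ-injective a≡b) (toℕ-injective i≡j)
  key-injective {a , centre} {b , centre} (a≡b ∷ _) = cong (_, centre) (toℕ-injective a≡b)
  key-injective {a , slot k c} {b , slot l d} (a≡b ∷ k≡l ∷ _ ∷ c≡d ∷ []) =
    cong₂ _,_ (toℕ-injective a≡b) (cong₂ slot (toℕ-injective (ℕ.suc-injective k≡l)) (toℕ-injective c≡d))
  key-injective {_ , marker _} {_ , centre}     (_ ∷ _ ∷ () ∷ _)
  key-injective {_ , marker _} {_ , slot _ _}   (_ ∷ _ ∷ () ∷ _)
  key-injective {_ , centre}   {_ , marker _}   (_ ∷ _ ∷ () ∷ _)
  key-injective {_ , centre}   {_ , slot _ _}   (_ ∷ () ∷ _)
  key-injective {_ , slot _ _} {_ , marker _}   (_ ∷ _ ∷ () ∷ _)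
  key-injective {_ , slot _ _} {_ , centre}     (_ ∷ () ∷ _)

  <ᵖ-isStrictTotalOrder : IsStrictTotalOrder _≡_ _<ᵖ_
  <ᵖ-isStrictTotalOrder = isStrictTotalOrder-on key key-injective (Lex.<-isStrictTotalOrder ℕ.<-isStrictTotalOrder)

  open IsStrictTotalOrder <ᵖ-isStrictTotalOrder public using () renaming (irrefl to <ᵖ-irrefl; asym to <ᵖ-asym)

  marker-<ᵖ : ∀ {a i j} → (a , marker i) <ᵖ (a , marker j) → toℕ i < toℕ j
  marker-<ᵖ (this a<a _)                            = ⊥-elim (ℕ.<-irrefl refl a<a)
  marker-<ᵖ (next _ (this i<j _))                   = i<j
  marker-<ᵖ (next _ (next _ (this () _)))
  marker-<ᵖ (next _ (next _ (next _ (this () _))))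
  marker-<ᵖ (next _ (next _ (next _ (next _ (base ())))))

  InGap : Fin n → Fin 5 → Point n → Set
  InGap a zero    p = p ≡ (a , centre)
  InGap a (suc k) p = ∃[ b ] p ≡ (a , slot k b)

  between-markers⇔InGap : ∀ g {a p} → ((a , marker (inject₁ g)) <ᵖ p × p <ᵖ (a , marker (suc g))) ⇔ InGap a g p
  between-markers⇔InGap g {a} {p} = mk⇔
    (λ (l , r) → inhabitant g p (subst (λ i → (toℕ a ∷ i ∷ 0 ∷ 0 ∷ []) <ˡ key p) (toℕ-inject₁ g) l) r)
    (between g)
    where
    inhabitant : ∀ g p → (toℕ a ∷ toℕ g ∷ 0 ∷ 0 ∷ []) <ˡ key p → key p <ˡ (toℕ a ∷ suc (toℕ g) ∷ 0 ∷ 0 ∷ []) →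
                 InGap a g p
    inhabitant g (c , marker i) l r with squeeze l r
    ... | _ , _ , 0∷0<0∷0 = ⊥-elim (Lex.<-irrefl ℕ.<-irrefl (refl ∷ refl ∷ []) 0∷0<0∷0)
    inhabitant zero (c , centre) l r with squeeze l r
    ... | c≡a , _ , _ = cong (_, centre) (toℕ-injective c≡a)
    inhabitant (suc _) (c , centre) l r with squeeze l r
    ... | _ , () , _
    inhabitant zero (c , slot _ _) l r with squeeze l r
    ... | _ , () , _
    inhabitant (suc k) (c , slot j b) l r with squeeze l r
    ... | c≡a , j≡k , _ = b , cong₂ (λ c j → c , slot j b) (toℕ-injective c≡a) (toℕ-injective (ℕ.suc-injective j≡k))

    between : ∀ g {p} → InGap a g p → (a , marker (inject₁ g)) <ᵖ p × p <ᵖ (a , marker (suc g))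
    between zero    refl      = next refl (next refl (this (s≤s z≤n) refl)) , next refl (this (s≤s z≤n) refl)
    between (suc k) (b , refl) =
      next refl (next (cong suc (toℕ-inject₁ k)) (this (s≤s z≤n) refl)) , next refl (this ℕ.≤-refl refl)

_<ᶠ_ _≈ᶠ_ : ∀ {m} → Fin m → Fin m → QF SymLEq m
i <ᶠ j = atom lt i j
i ≈ᶠ j = atom eqv i j

stepF : ∀ {m} → Fin m → Fin m → QF SymLEq m
stepF i j = and (i <ᶠ j) (i ≈ᶠ j)

chainF : ∀ {m} → (Fin 6 → Fin m) → QF SymLEq m
chainF v = and (stepF (v 0F) (v 1F)) (and (stepF (v 1F) (v 2F)) (and (stepF (v 2F) (v 3F))
           (and (stepF (v 3F) (v 4F)) (stepF (v 4F) (v 5F)))))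

gapF : ∀ {m} → (Fin 6 → Fin m) → Fin 5 → Fin m → QF SymLEq m
gapF v g z = and (v (inject₁ g) <ᶠ z) (z <ᶠ v (suc g))

centreF : ∀ {m} → (Fin 6 → Fin m) → Fin m → QF SymLEq m
centreF v x = and (chainF v) (gapF v 0F x)

slotF : ∀ {m} → (Fin 6 → Fin m) → Fin m → Fin 4 → Fin m → QF SymLEq m
slotF v x k u = and (centreF v x) (gapF v (suc k) u)

universeF : Σ₁ SymLEq 1
universeF = ∃∃ 6 (centreF (_↑ˡ 1) (# 6))

-- Bound variables 0–5 and 6–11 are the markers of the blocks of the free variables x = 14 and y = 15;
-- 12 and 13 are slots of zone k in these blocks.
xMarker yMarker : Fin 6 → Fin 16
xMarker i = (i ↑ˡ 8) ↑ˡ 2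
yMarker i = (6 ↑ʳ (i ↑ˡ 2)) ↑ˡ 2

linkF : Fin 4 → QF SymLEq 16
linkF k = and (slotF xMarker (# 14) k (# 12)) (and (slotF yMarker (# 15) k (# 13)) ((# 12) ≈ᶠ (# 13)))

relationF distinctRelationF : Fin 4 → Σ₁ SymLEq 2
relationF k         = ∃∃ 14 (linkF k)
distinctRelationF k = ∃∃ 14 (and (linkF k) (neg (equal (# 12) (# 13))))

module Linking {n : ℕ} (G : Fin 4 → Rel (Fin n) 0ℓ) where

  data _≈ᵖ_ : Rel (Point n) 0ℓ where
    identical : ∀ {p} → p ≈ᵖ p
    markers   : ∀ {a i j} → (a , marker i) ≈ᵖ (a , marker j)
    linked    : ∀ {k a b} → G k a b → (a , slot k b) ≈ᵖ (b , slot k a)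

  ≈ᵖ-isEquivalence : (∀ k → Symmetric (G k)) → IsEquivalence _≈ᵖ_
  ≈ᵖ-isEquivalence G-sym = record { refl = identical ; sym = ≈ᵖ-sym ; trans = ≈ᵖ-trans }
    where
    ≈ᵖ-sym : Symmetric _≈ᵖ_
    ≈ᵖ-sym identical  = identical
    ≈ᵖ-sym markers    = markers
    ≈ᵖ-sym (linked g) = linked (G-sym _ g)

    ≈ᵖ-trans : Transitive _≈ᵖ_
    ≈ᵖ-trans identical  q          = q
    ≈ᵖ-trans p          identical  = p
    ≈ᵖ-trans markers    markers    = markers
    ≈ᵖ-trans (linked _) (linked _) = identical

  gadget : SymLEq → Rel (Point n) 0ℓ
  gadget lt  = _<ᵖ_
  gadget eqv = _≈ᵖ_

  open Semantics gadget public

  Step : Rel (Point n) 0ℓ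
  Step p q = p <ᵖ q × p ≈ᵖ q

  Chain : (Fin 6 → Point n) → Set
  Chain m = Step (m 0F) (m 1F) × Step (m 1F) (m 2F) × Step (m 2F) (m 3F) × Step (m 3F) (m 4F) × Step (m 4F) (m 5F)

  Chain-resp : ∀ {m m′} → m ≗ m′ → Chain m → Chain m′
  Chain-resp m≗m′ (s₀ , s₁ , s₂ , s₃ , s₄) = step 0F 1F s₀ , step 1F 2F s₁ , step 2F 3F s₂ , step 3F 4F s₃ , step 4F 5F s₄
    where step = λ i j → subst₂ Step (m≗m′ i) (m≗m′ j)

  markers-chain : ∀ a → Chain (blockMarkers a)
  markers-chain a = step refl , step refl , step refl , step refl , step refl
    where
    step : ∀ {i j} → toℕ j ≡ suc (toℕ i) → Step (a , marker i) (a , marker j)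
    step j≡1+i = next refl (this (ℕ.≤-reflexive (sym j≡1+i)) refl) , markers

  marker-step : ∀ {a i q} → Step (a , marker i) q → ∃[ j ] toℕ i < toℕ j × q ≡ (a , marker j)
  marker-step {a} {i} (i<i , identical) = ⊥-elim (<ᵖ-irrefl {x = a , marker i} refl i<i)
  marker-step         (i<j , markers)   = _ , marker-<ᵖ i<j , refl

  two-steps⇒marker : ∀ {p q r} → Step p q → Step q r → ∃₂ λ a i → p ≡ (a , marker i)
  two-steps⇒marker         (_ , markers)     _                 = _ , _ , refl
  two-steps⇒marker {p}     (p<p , identical) _                 = ⊥-elim (<ᵖ-irrefl {x = p} refl p<p)
  two-steps⇒marker {q = q} (_ , linked _)    (q<q , identical) = ⊥-elim (<ᵖ-irrefl {x = q} refl q<q)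
  two-steps⇒marker {p} {q} (p<q , linked _)  (q<p , linked _)  = ⊥-elim (<ᵖ-asym {x = p} {q} p<q q<p)

  MarksBlock : ∀ {k} → (Fin k → Point n) → (Fin 6 → Fin k) → Fin n → Set
  MarksBlock σ v a = ∀ i → σ (v i) ≡ (a , marker i)

  marker-at : ∀ {p : Point n} {a i j} → p ≡ (a , marker i) → toℕ i ≡ toℕ j → p ≡ (a , marker j)
  marker-at {a = a} p≡ i≡j = trans p≡ (cong (blockMarkers a) (toℕ-injective i≡j))

  chain⇒markers : ∀ {k σ} {v : Fin 6 → Fin k} → Chain (σ ∘ v) → ∃[ a ] MarksBlock σ v a
  chain⇒markers {σ = σ} {v} (s₀ , s₁ , s₂ , s₃ , s₄) =
    let a  , i₀ , e₀ = two-steps⇒marker s₀ s₁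
        i₁ , l₁ , e₁ = marker-step (subst (λ p → Step p (σ (v 1F))) e₀ s₀)
        i₂ , l₂ , e₂ = marker-step (subst (λ p → Step p (σ (v 2F))) e₁ s₁)
        i₃ , l₃ , e₃ = marker-step (subst (λ p → Step p (σ (v 3F))) e₂ s₂)
        i₄ , l₄ , e₄ = marker-step (subst (λ p → Step p (σ (v 4F))) e₃ s₃)
        i₅ , l₅ , e₅ = marker-step (subst (λ p → Step p (σ (v 5F))) e₄ s₄)
        t₀ , t₁ , t₂ , t₃ , t₄ , t₅ = increasing-below-six l₁ l₂ l₃ l₄ l₅ (toℕ<n i₅)
    in a , λ { 0F → marker-at e₀ t₀ ; 1F → marker-at e₁ t₁ ; 2F → marker-at e₂ t₂
             ; 3F → marker-at e₃ t₃ ; 4F → marker-at e₄ t₄ ; 5F → marker-at e₅ t₅ }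

  module _ {m} {σ : Fin m → Point n} {v : Fin 6 → Fin m} where

    gapF⇔InGap : ∀ {a} g {z} → MarksBlock σ v a → ⟦ gapF v g z ⟧qfᴿ σ ⇔ InGap a g (σ z)
    gapF⇔InGap g marks =
      between-markers⇔InGap g ⇔-∘ (subst₂-⇔ _<ᵖ_ (marks _) refl ×-⇔ subst₂-⇔ _<ᵖ_ refl (marks _))

    centreF-sound : ∀ {x} → ⟦ centreF v x ⟧qfᴿ σ → ∃[ a ] MarksBlock σ v a × σ x ≡ (a , centre)
    centreF-sound (chain , gap) =
      let a , marks = chain⇒markers {σ = σ} {v} chain in a , marks , Equivalence.to (gapF⇔InGap 0F marks) gap

    centreF-complete : ∀ {a x} → MarksBlock σ v a → σ x ≡ (a , centre) → ⟦ centreF v x ⟧qfᴿ σ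
    centreF-complete {a} marks x≡ =
      Chain-resp (sym ∘ marks) (markers-chain a) , Equivalence.from (gapF⇔InGap 0F marks) x≡

    slotF-sound : ∀ {x k u} → ⟦ slotF v x k u ⟧qfᴿ σ → ∃[ a ] σ x ≡ (a , centre) × ∃[ b ] σ u ≡ (a , slot k b)
    slotF-sound {k = k} (centred , gap) =
      let a , marks , x≡ = centreF-sound centred in a , x≡ , Equivalence.to (gapF⇔InGap (suc k) marks) gap

    slotF-complete : ∀ {a b x k u} → MarksBlock σ v a → σ x ≡ (a , centre) → σ u ≡ (a , slot k b) →
                     ⟦ slotF v x k u ⟧qfᴿ σ
    slotF-complete {b = b} {k = k} marks x≡ u≡ =
      centreF-complete marks x≡ , Equivalence.from (gapF⇔InGap (suc k) marks) (b , u≡)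

  universeF⇔centre : ∀ {p} → ⟦ universeF ⟧ᴿ (one p) ⇔ (∃[ a ] p ≡ (a , centre))
  universeF⇔centre {p} = mk⇔ sound complete
    where
    sound : ⟦ universeF ⟧ᴿ (one p) → ∃[ a ] p ≡ (a , centre)
    sound (w , centred) = let a , _ , p≡ = centreF-sound {σ = w ++ one p} {_↑ˡ 1} {# 6} centred in a , p≡

    complete : ∃[ a ] p ≡ (a , centre) → ⟦ universeF ⟧ᴿ (one p)
    complete (a , refl) = blockMarkers a , centreF-complete {σ = blockMarkers a ++ one p} {_↑ˡ 1} {x = # 6}
                                             (lookup-++ˡ (blockMarkers a) (one p)) refl

  linkWitness : Fin n → Fin n → Point n → Point n → Fin 14 → Point n
  linkWitness a a′ u v = blockMarkers a ++ (blockMarkers a′ ++ two u v)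

  linkF-complete : ∀ {k a a′ b b′} → (a , slot k b) ≈ᵖ (a′ , slot k b′) →
                   ⟦ linkF k ⟧qfᴿ (linkWitness a a′ (a , slot k b) (a′ , slot k b′) ++ two (a , centre) (a′ , centre))
  linkF-complete {k} {a} {a′} {b} {b′} u≈v =
    slotF-complete {σ = σ} {xMarker} {b = b} {x = # 14} {k} {# 12} xMarks refl refl ,
    slotF-complete {σ = σ} {yMarker} {b = b′} {x = # 15} {k} {# 13} yMarks refl refl , u≈v
    where
    w = linkWitness a a′ (a , slot k b) (a′ , slot k b′)
    σ = w ++ two (a , centre) (a′ , centre)

    xMarks : MarksBlock σ xMarker a
    xMarks i = trans (lookup-++ˡ w (two (a , centre) (a′ , centre)) (i ↑ˡ 8))
                     (lookup-++ˡ (blockMarkers a) (blockMarkers a′ ++ two (a , slot k b) (a′ , slot k b′)) i)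

    yMarks : MarksBlock σ yMarker a′
    yMarks i = trans (lookup-++ˡ w (two (a , centre) (a′ , centre)) (6 ↑ʳ (i ↑ˡ 2)))
                     (trans (lookup-++ʳ (blockMarkers a) (blockMarkers a′ ++ two (a , slot k b) (a′ , slot k b′)) (i ↑ˡ 2))
                            (lookup-++ˡ (blockMarkers a′) (two (a , slot k b) (a′ , slot k b′)) i))

  linkF-sound : ∀ {k a a′} {w : Fin 14 → Point n} → let σ = w ++ two (a , centre) (a′ , centre) in
                ⟦ linkF k ⟧qfᴿ σ →
                ∃₂ λ b b′ → σ (# 12) ≡ (a , slot k b) × σ (# 13) ≡ (a′ , slot k b′) × (a , slot k b) ≈ᵖ (a′ , slot k b′)
  linkF-sound {k} {a} {a′} {w} (x-slot , y-slot , u≈v)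
    with slotF-sound {σ = σ} {xMarker} {# 14} {k} {# 12} x-slot | slotF-sound {σ = σ} {yMarker} {# 15} {k} {# 13} y-slot
    where σ = w ++ two (a , centre) (a′ , centre)
  ... | _ , refl , b , u≡ | _ , refl , b′ , v≡ = b , b′ , u≡ , v≡ , subst₂ _≈ᵖ_ u≡ v≡ u≈v

  centres-of-linked-slots : ∀ {k a a′ b b′} → (a , slot k b) ≈ᵖ (a′ , slot k b′) → a ≡ a′ ⊎ G k a a′
  centres-of-linked-slots identical  = inj₁ refl
  centres-of-linked-slots (linked g) = inj₂ g

  centres-of-distinct-linked-slots : ∀ {k a a′ b b′} → (a , slot k b) ≈ᵖ (a′ , slot k b′) →
                                     _≢_ {A = Point n} (a , slot k b) (a′ , slot k b′) → a ≢ a′ × G k a a′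
  centres-of-distinct-linked-slots identical  u≢v = ⊥-elim (u≢v refl)
  centres-of-distinct-linked-slots (linked g) u≢v = (λ { refl → u≢v refl }) , g

  relationF⇔ : ∀ {k a a′} → ⟦ relationF k ⟧ᴿ (two (a , centre) (a′ , centre)) ⇔ (a ≡ a′ ⊎ G k a a′)
  relationF⇔ {k} {a} {a′} = mk⇔ sound complete
    where
    sound : ⟦ relationF k ⟧ᴿ (two (a , centre) (a′ , centre)) → a ≡ a′ ⊎ G k a a′
    sound (_ , linkedSlots) = let _ , _ , _ , _ , u≈v = linkF-sound {k} {a} {a′} linkedSlots in centres-of-linked-slots u≈v

    complete : a ≡ a′ ⊎ G k a a′ → ⟦ relationF k ⟧ᴿ (two (a , centre) (a′ , centre))
    complete (inj₁ refl) = linkWitness a a (a , slot k a) (a , slot k a) , linkF-complete identical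
    complete (inj₂ g)    = linkWitness a a′ (a , slot k a′) (a′ , slot k a) , linkF-complete (linked g)

  distinctRelationF⇔ : ∀ {k a a′} → ⟦ distinctRelationF k ⟧ᴿ (two (a , centre) (a′ , centre)) ⇔ (a ≢ a′ × G k a a′)
  distinctRelationF⇔ {k} {a} {a′} = mk⇔ sound complete
    where
    sound : ⟦ distinctRelationF k ⟧ᴿ (two (a , centre) (a′ , centre)) → a ≢ a′ × G k a a′
    sound (_ , linkedSlots , u≢v) =
      let _ , _ , u≡ , v≡ , u≈v = linkF-sound {k} {a} {a′} linkedSlots
      in centres-of-distinct-linked-slots u≈v (λ e → u≢v (trans u≡ (trans e (sym v≡))))

    complete : a ≢ a′ × G k a a′ → ⟦ distinctRelationF k ⟧ᴿ (two (a , centre) (a′ , centre))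
    complete (a≢a′ , g) = linkWitness a a′ (a , slot k a′) (a′ , slot k a) , linkF-complete (linked g) , a≢a′ ∘ cong proj₁

scheme : Scheme Sym2Eq SymLEq
scheme = record
  { ΦU  = universeF
  ; ΦR  = λ { P → relationF 0F ; Q → relationF 2F }
  ; Φ¬R = λ { P → distinctRelationF 1F ; Q → distinctRelationF 3F }
  }

module Interpretation (A : Structure Sym2Eq) (A-2Eq : Is2Eq A) where

  module ≡A s = IsEquivalence (A-2Eq s)

  G : Fin 4 → Rel (Fin (size A)) 0ℓ
  G 0F     = rel A P
  G 1F a b = ¬ rel A P a b
  G 2F     = rel A Q
  G 3F a b = ¬ rel A Q a b

  G-sym : ∀ k → Symmetric (G k)
  G-sym 0F = ≡A.sym P
  G-sym 1F ¬Pab Pba = ¬Pab (≡A.sym P Pba)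
  G-sym 2F = ≡A.sym Q
  G-sym 3F ¬Qab Qba = ¬Qab (≡A.sym Q Qba)

  open Linking G
  open Transport gadget (ℕ.*-mono-< (nonempty A) (s≤s z≤n)) (point↔ {size A})
  open SetoidReasoning (⇔-setoid 0ℓ)

  B : Structure SymLEq
  B = structure

  B-LEq : IsLEq B
  B-LEq = isStrictTotalOrder-on to to-injective <ᵖ-isStrictTotalOrder
        , On.isEquivalence to (≈ᵖ-isEquivalence G-sym)

  iso : Fin (size A) → Fin (size B)
  iso a = from (a , centre)

  in-universe⇔ : ∀ b → ⟦ universeF ⟧ B (one b) ⇔ (∃[ a ] to b ≡ (a , centre))
  in-universe⇔ b = universeF⇔centre {to b} ⇔-∘ ⟦⟧-transport universeF (one b)

  iso-into : ∀ a → ⟦ universeF ⟧ B (one (iso a))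
  iso-into a = Equivalence.from (in-universe⇔ (iso a)) (a , strictlyInverseˡ _)

  iso-onto : ∀ b → ⟦ universeF ⟧ B (one b) → ∃[ a ] iso a ≡ b
  iso-onto b b∈U = help (Equivalence.to (in-universe⇔ b) b∈U)
    where
    help : (∃[ a ] to b ≡ (a , centre)) → ∃[ a ] iso a ≡ b
    help (a , to-b≡) = a , trans (cong from (sym to-b≡)) (strictlyInverseʳ b)

  at-centres : ∀ φ {a a′} → ⟦ φ ⟧ B (two (iso a) (iso a′)) ⇔ ⟦ φ ⟧ᴿ (two (a , centre) (a′ , centre))
  at-centres φ = ⟦⟧ᴿ-cong φ (λ { 0F → strictlyInverseˡ _ ; 1F → strictlyInverseˡ _ }) ⇔-∘ ⟦⟧-transport φ _

  relation-interpreted : ∀ k → Reflexive (G k) → ∀ {a a′} → G k a a′ ⇔ ⟦ relationF k ⟧ B (two (iso a) (iso a′))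
  relation-interpreted k G-refl {a} {a′} = begin
    G k a a′                                          ≈⟨ mk⇔ inj₂ [ (λ { refl → G-refl }) , id ] ⟩
    (a ≡ a′ ⊎ G k a a′)                               ≈⟨ ⇔-sym (relationF⇔ {k} {a} {a′}) ⟩
    ⟦ relationF k ⟧ᴿ (two (a , centre) (a′ , centre)) ≈⟨ ⇔-sym (at-centres (relationF k) {a} {a′}) ⟩
    ⟦ relationF k ⟧ B (two (iso a) (iso a′))          ∎

  complement-interpreted : ∀ k k′ → (∀ {a a′} → G k′ a a′ ⇔ (¬ G k a a′)) → ∀ {a a′} →
    ⟦ distinctRelationF k′ ⟧ B (two (iso a) (iso a′)) ⇔ (¬ ⟦ relationF k ⟧ B (two (iso a) (iso a′)))
  complement-interpreted k k′ G′⇔¬G {a} {a′} = begin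
    ⟦ distinctRelationF k′ ⟧ B (two (iso a) (iso a′))           ≈⟨ at-centres (distinctRelationF k′) {a} {a′} ⟩
    ⟦ distinctRelationF k′ ⟧ᴿ (two (a , centre) (a′ , centre)) ≈⟨ distinctRelationF⇔ {k′} {a} {a′} ⟩
    (a ≢ a′ × G k′ a a′)                                       ≈⟨ ⇔-id _ ×-⇔ G′⇔¬G ⟩
    (a ≢ a′ × ¬ G k a a′)                                      ≈⟨ ¬⊎⇔¬×¬ ⟩
    (¬ (a ≡ a′ ⊎ G k a a′))                                    ≈⟨ ¬-cong-⇔ (⇔-sym (relationF⇔ {k} {a} {a′})) ⟩
    (¬ ⟦ relationF k ⟧ᴿ (two (a , centre) (a′ , centre)))      ≈⟨ ¬-cong-⇔ (⇔-sym (at-centres (relationF k) {a} {a′})) ⟩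
    (¬ ⟦ relationF k ⟧ B (two (iso a) (iso a′)))               ∎

  iso-injective : ∀ {a a′} → iso a ≡ iso a′ → a ≡ a′
  iso-injective {a} {a′} iso-a≡iso-a′ = cong proj₁ (from-injective {a , centre} {a′ , centre} iso-a≡iso-a′)

  complement-at-centres : ∀ s a a′ →
    ⟦ Φ¬R scheme s ⟧ B (two (iso a) (iso a′)) ⇔ (¬ ⟦ ΦR scheme s ⟧ B (two (iso a) (iso a′)))
  complement-at-centres P a a′ = complement-interpreted 0F 1F (⇔-id _) {a} {a′}
  complement-at-centres Q a a′ = complement-interpreted 2F 3F (⇔-id _) {a} {a′}

  interprets : Interprets scheme A B
  interprets = record
    { B'-nonempty = iso a₀ , iso-into a₀
    ; complement  = complement
    ; iso         = iso
    ; iso-inj     = iso-injective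
    ; iso-into    = iso-into
    ; iso-onto    = iso-onto
    ; iso-rel     = λ { P a a′ → relation-interpreted 0F (≡A.refl P) {a} {a′}
                      ; Q a a′ → relation-interpreted 2F (≡A.refl Q) {a} {a′} }
    }
    where
    a₀ = fromℕ< (nonempty A)

    complement : ∀ s x y → ⟦ universeF ⟧ B (one x) → ⟦ universeF ⟧ B (one y) →
                 ⟦ Φ¬R scheme s ⟧ B (two x y) ⇔ (¬ ⟦ ΦR scheme s ⟧ B (two x y))
    complement s x y x∈U y∈U =
      let a , iso-a≡x = iso-onto x x∈U
          a′ , iso-a′≡y = iso-onto y y∈U
      in subst₂ (λ x y → ⟦ Φ¬R scheme s ⟧ B (two x y) ⇔ (¬ ⟦ ΦR scheme s ⟧ B (two x y)))
                iso-a≡x iso-a′≡y (complement-at-centres s a a′)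

theorem2 : Σ₁-Interpretable Is2Eq IsLEq
theorem2 = scheme , λ A A-2Eq → let open Interpretation A A-2Eq in B , B-LEq , interprets
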